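{- Let $r\ge2$ and $n\ge 3$. Let $u_n$ be the word over $\{H,v\}$ obtained from the Christoffel word of $\mathcal{C}_n$ by replacing each $E$ by $H$ and each $N$ by $v$. Then $w_q(u_n)=c_{n-1}+c_{n-2}-1$.
   Context: Define integers $c_1=0$, $c_2=1$, $c_n=rc_{n-1}-c_{n-2}$ for $n\ge 3$. For coprime nonnegative integers $a,b$, the maximal Dyck path $\mathcal{P}(a,b)$ is the lattice path from $(0,0)$ to $(a,b)$ using unit north and east steps that never passes strictly above the segment from $(0,0)$ to $(a,b)$ and whose height at each vertex is maximal among such paths; its Christoffel word records its steps in order ($E$ east, $N$ north). $\mathcal{C}_n=\mathcal{P}(c_{n-1},c_{n-2})$. On the alphabet $\{h,v,H,V\}$ define $w_q$ on two-letter words by $w_q(hv)=w_q(Hv)=w_q(hV)=1$, $w_q(Hh)=w_q(vV)=r$, $w_q(VH)=r^2-1$, and $w_q(xy)=-w_q(yx)$ for all letters $x,y$ (so $w_q(xx)=0$). For a word $x_1x_2\cdots x_\ell$, set $w_q(x_1\cdots x_\ell)=\sum_{1\le p<p'\le \ell}w_q(x_px_{p'})$. -}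

module Defs where

open import Data.Nat as ℕ using (ℕ; zero; suc; _≤ᵇ_)
open import Data.Integer as ℤ using (ℤ; +_; -[1+_]; _-_; ∣_∣)
open import Data.Bool using (if_then_else_; _∧_)
open import Data.List using (List; []; _∷_; map; foldr)
open import Data.Integer using () renaming (_+_ to _+ℤ_; _*_ to _*ℤ_)

-- The sequence c_n (depending on the parameter r), as integers.
-- c 1 = 0, c 2 = 1, c n = r c (n-1) - c (n-2) for n ≥ 3.
-- c 0 is set to -1 (the value forced by the recurrence backwards); it is
-- never used in the statement (only c_k with k ≥ 1 appear).
c : ℕ → ℕ → ℤ
c r zero = -[1+ 0 ]
c r (suc zero) = + 0
c r (suc (suc n)) = (+ r) *ℤ c r (suc n) - c r n

data Step : Set where
  E N : Step

-- Maximal Dyck path P(a,b) (greedy construction): starting from (x,y),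
-- go north whenever the point (x, y+1) is not strictly above the segment
-- from (0,0) to (a,b), i.e. (y+1)·a ≤ x·b, and y < b; otherwise go east.
-- This yields at every vertex the maximal height among paths staying weakly
-- below the segment.
pathFrom : (a b x y fuel : ℕ) → List Step
pathFrom a b x y zero = []
pathFrom a b x y (suc fuel) =
  if (suc y ℕ.* a ≤ᵇ x ℕ.* b) ∧ (suc y ≤ᵇ b)
  then N ∷ pathFrom a b x (suc y) fuel
  else E ∷ pathFrom a b (suc x) y fuel

christoffel : ℕ → ℕ → List Step
christoffel a b = pathFrom a b 0 0 (a ℕ.+ b)

data Letter : Set where
  h v H V : Letter

w2 : ℕ → Letter → Letter → ℤ
w2 r h v = + 1
w2 r H v = + 1
w2 r h V = + 1
w2 r H h = + r
w2 r v V = + r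
w2 r V H = (+ r) *ℤ (+ r) - + 1
w2 r v h = ℤ.- + 1
w2 r v H = ℤ.- + 1
w2 r V h = ℤ.- + 1
w2 r h H = ℤ.- (+ r)
w2 r V v = ℤ.- (+ r)
w2 r H V = ℤ.- ((+ r) *ℤ (+ r) - + 1)
w2 r h h = + 0
w2 r v v = + 0
w2 r H H = + 0
w2 r V V = + 0

wq : ℕ → List Letter → ℤ
wq r [] = + 0
wq r (x ∷ xs) = foldr _+ℤ_ (+ 0) (map (w2 r x) xs) +ℤ wq r xs

toHv : Step → Letter
toHv E = H
toHv N = v

-- u_n : Christoffel word of C_n = P(c_{n-1}, c_{n-2}) with E ↦ H, N ↦ v.
-- (c_k ≥ 0 for k ≥ 1 when r ≥ 2, so ∣_∣ is just the coercion to ℕ.)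
u : ℕ → ℕ → List Letter
u r n = map toHv (christoffel ∣ c r (n ℕ.∸ 1) ∣ ∣ c r (n ℕ.∸ 2) ∣)

-- Over {H, v} the weight w_q only sees the pairs Hv (+1) and vH (-1), so
-- w_q(u_n) is the number of E-before-N pairs minus the number of N-before-E
-- pairs in the Christoffel word of (a, b) = (c_{n-1}, c_{n-2}).  For coprime
-- a ≥ 1, b this balance is a + b - 1: following the Euclidean algorithm, every
-- Christoffel word arises from that of (1, 0) or (1, 1) by the morphisms
-- E ↦ E, N ↦ EN and E ↦ EN, N ↦ N, and each of them raises the balance by
-- the number of occurrences of the letter it does not fix.  Consecutive c_k
-- are coprime because c_{k+1} + c_{k-1} = r c_k.
module Submission where

open import Defs
open import Data.Nat using (ℕ; _≤_; _∸_)
open import Data.Integer using (ℤ; +_; _+_; _-_)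
open import Relation.Binary.PropositionalEquality using (_≡_)

open import Data.Nat as ℕ using (zero; suc; _<_; z≤n; s≤s; _≤?_)
import Data.Nat.Properties as ℕ
import Data.Integer as ℤ
import Data.Integer.Properties as ℤ
open import Data.Integer.Tactic.RingSolver using (solve-∀)
open import Data.Nat.Divisibility using (_∣_; ∣m+n∣m⇒∣n; ∣m∣n⇒∣m+n; ∣-refl; ∣-trans; n∣m*n; ∣1⇒≡1)
open import Data.Nat.Coprimality as Coprime using (Coprime; 0-coprimeTo-m⇒m≡1)
open import Relation.Binary.Definitions using (tri<; tri≈; tri>)
open import Data.List using (List; []; _∷_; map; foldr)
open import Data.Bool using (true; false)
open import Data.Product using (_,_)
open import Relation.Nullary using (¬_; yes; no; contradiction)
open import Relation.Nullary.Decidable using (dec-true; dec-false)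
open import Relation.Binary.PropositionalEquality
  using (refl; sym; trans; cong; cong₂; subst; module ≡-Reasoning)

#E #N : List Step → ℕ
#E [] = 0
#E (E ∷ w) = suc (#E w)
#E (N ∷ w) = #E w
#N [] = 0
#N (E ∷ w) = #N w
#N (N ∷ w) = suc (#N w)

pairBalance : List Step → ℤ
pairBalance [] = + 0
pairBalance (E ∷ w) = + #N w + pairBalance w
pairBalance (N ∷ w) = ℤ.- (+ #E w) + pairBalance w

wq-toHv : ∀ r w → wq r (map toHv w) ≡ pairBalance w
wq-toHv r [] = refl
wq-toHv r (E ∷ w) = cong₂ _+_ (sum-w2-H w) (wq-toHv r w)
  where
  sum-w2-H : ∀ w → foldr _+_ (+ 0) (map (w2 r H) (map toHv w)) ≡ + #N w
  sum-w2-H [] = refl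
  sum-w2-H (E ∷ w) = cong (_+_ (+ 0)) (sum-w2-H w)
  sum-w2-H (N ∷ w) = cong (_+_ (+ 1)) (sum-w2-H w)
wq-toHv r (N ∷ w) = cong₂ _+_ (sum-w2-v w) (wq-toHv r w)
  where
  sum-w2-v : ∀ w → foldr _+_ (+ 0) (map (w2 r v) (map toHv w)) ≡ ℤ.- (+ #E w)
  sum-w2-v [] = refl
  sum-w2-v (E ∷ w) = trans (cong (_+_ (ℤ.- (+ 1))) (sum-w2-v w)) (sym (ℤ.neg-distrib-+ (+ 1) (+ #E w)))
  sum-w2-v (N ∷ w) = trans (cong (_+_ (+ 0)) (sum-w2-v w)) (ℤ.+-identityˡ _)

-- The Christoffel morphisms: shearE maps the Christoffel word of (a, b) to
-- that of (a + b, b), shearN maps it to that of (a, a + b).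
shearE shearN : List Step → List Step
shearE [] = []
shearE (E ∷ w) = E ∷ shearE w
shearE (N ∷ w) = E ∷ N ∷ shearE w
shearN [] = []
shearN (E ∷ w) = E ∷ N ∷ shearN w
shearN (N ∷ w) = N ∷ shearN w

#E-shearE : ∀ w → #E (shearE w) ≡ #E w ℕ.+ #N w
#E-shearE [] = refl
#E-shearE (E ∷ w) = cong suc (#E-shearE w)
#E-shearE (N ∷ w) = trans (cong suc (#E-shearE w)) (sym (ℕ.+-suc _ _))

#N-shearE : ∀ w → #N (shearE w) ≡ #N w
#N-shearE [] = refl
#N-shearE (E ∷ w) = #N-shearE w
#N-shearE (N ∷ w) = cong suc (#N-shearE w)

#E-shearN : ∀ w → #E (shearN w) ≡ #E w
#E-shearN [] = refl
#E-shearN (E ∷ w) = cong suc (#E-shearN w)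
#E-shearN (N ∷ w) = #E-shearN w

#N-shearN : ∀ w → #N (shearN w) ≡ #N w ℕ.+ #E w
#N-shearN [] = refl
#N-shearN (E ∷ w) = trans (cong suc (#N-shearN w)) (sym (ℕ.+-suc _ _))
#N-shearN (N ∷ w) = cong suc (#N-shearN w)

pairBalance-shearE : ∀ w → pairBalance (shearE w) ≡ pairBalance w + + #N w
pairBalance-shearE [] = refl
pairBalance-shearE (E ∷ w) = begin
  + #N (shearE w) + pairBalance (shearE w)
    ≡⟨ cong₂ _+_ (cong +_ (#N-shearE w)) (pairBalance-shearE w) ⟩
  + #N w + (pairBalance w + + #N w)
    ≡⟨ ℤ.+-assoc (+ #N w) (pairBalance w) (+ #N w) ⟨
  + #N w + pairBalance w + + #N w ∎
  where open ≡-Reasoning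
pairBalance-shearE (N ∷ w) = begin
  + suc (#N (shearE w)) + (ℤ.- (+ #E (shearE w)) + pairBalance (shearE w))
    ≡⟨ cong₂ (λ n e → + suc n + (ℤ.- (+ e) + pairBalance (shearE w))) (#N-shearE w) (#E-shearE w) ⟩
  + suc (#N w) + (ℤ.- (+ (#E w ℕ.+ #N w)) + pairBalance (shearE w))
    ≡⟨ cong₂ (λ e p → + suc (#N w) + (ℤ.- e + p)) (ℤ.pos-+ (#E w) (#N w)) (pairBalance-shearE w) ⟩
  + 1 + + #N w + (ℤ.- (+ #E w + + #N w) + (pairBalance w + + #N w))
    ≡⟨ regroup (+ #N w) (+ #E w) (pairBalance w) ⟩
  ℤ.- (+ #E w) + pairBalance w + (+ 1 + + #N w) ∎
  where
  open ≡-Reasoning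
  regroup : ∀ n e p → + 1 + n + (ℤ.- (e + n) + (p + n)) ≡ ℤ.- e + p + (+ 1 + n)
  regroup = solve-∀

pairBalance-shearN : ∀ w → pairBalance (shearN w) ≡ pairBalance w + + #E w
pairBalance-shearN [] = refl
pairBalance-shearN (E ∷ w) = begin
  + suc (#N (shearN w)) + (ℤ.- (+ #E (shearN w)) + pairBalance (shearN w))
    ≡⟨ cong₂ (λ n e → + suc n + (ℤ.- (+ e) + pairBalance (shearN w))) (#N-shearN w) (#E-shearN w) ⟩
  + suc (#N w ℕ.+ #E w) + (ℤ.- (+ #E w) + pairBalance (shearN w))
    ≡⟨ cong₂ (λ n p → + 1 + n + (ℤ.- (+ #E w) + p)) (ℤ.pos-+ (#N w) (#E w)) (pairBalance-shearN w) ⟩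
  + 1 + (+ #N w + + #E w) + (ℤ.- (+ #E w) + (pairBalance w + + #E w))
    ≡⟨ regroup (+ #N w) (+ #E w) (pairBalance w) ⟩
  + #N w + pairBalance w + (+ 1 + + #E w) ∎
  where
  open ≡-Reasoning
  regroup : ∀ n e p → + 1 + (n + e) + (ℤ.- e + (p + e)) ≡ n + p + (+ 1 + e)
  regroup = solve-∀
pairBalance-shearN (N ∷ w) = begin
  ℤ.- (+ #E (shearN w)) + pairBalance (shearN w)
    ≡⟨ cong₂ (λ e p → ℤ.- (+ e) + p) (#E-shearN w) (pairBalance-shearN w) ⟩
  ℤ.- (+ #E w) + (pairBalance w + + #E w)
    ≡⟨ ℤ.+-assoc (ℤ.- (+ #E w)) (pairBalance w) (+ #E w) ⟨
  ℤ.- (+ #E w) + pairBalance w + + #E w ∎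
  where open ≡-Reasoning

-- The Christoffel word produced by the Euclidean remainders: D plays the
-- role of x * b ∸ y * a at the current vertex (x , y).
cuttingWord : (a b D fuel : ℕ) → List Step
cuttingWord a b D zero = []
cuttingWord a b D (suc m) with a ≤? D
... | yes _ = N ∷ cuttingWord a b (D ∸ a) m
... | no _ = E ∷ cuttingWord a b (D ℕ.+ b) m

cuttingWord-N : ∀ {a b D m} → a ≤ D → cuttingWord a b D (suc m) ≡ N ∷ cuttingWord a b (D ∸ a) m
cuttingWord-N {a} {D = D} a≤D with a ≤? D
... | yes _ = refl
... | no a≰D = contradiction a≤D a≰D

cuttingWord-E : ∀ {a b D m} → ¬ a ≤ D → cuttingWord a b D (suc m) ≡ E ∷ cuttingWord a b (D ℕ.+ b) m
cuttingWord-E {a} {D = D} a≰D with a ≤? D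
... | yes a≤D = contradiction a≤D a≰D
... | no _ = refl

≤ᵇ-true : ∀ {m n} → m ≤ n → (m ℕ.≤ᵇ n) ≡ true
≤ᵇ-true {m} {n} = dec-true (m ≤? n)

≤ᵇ-false : ∀ {m n} → ¬ m ≤ n → (m ℕ.≤ᵇ n) ≡ false
≤ᵇ-false {m} {n} = dec-false (m ≤? n)

north-step-below-top : ∀ {a b} x y D fuel → 1 ≤ a → y ℕ.* a ℕ.+ D ≡ x ℕ.* b →
  x ℕ.+ y ℕ.+ suc fuel ≡ a ℕ.+ b → a ≤ D → suc y ≤ b
north-step-below-top {a} {b} x y D fuel 1≤a inv cnt a≤D with suc y ≤? b
... | yes y<b = y<b
... | no y≮b = contradiction impossible (ℕ.<-irrefl refl)
  where
  open ℕ.≤-Reasoning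
  b≤y : b ≤ y
  b≤y = ℕ.≤-pred (ℕ.≰⇒> y≮b)
  x≤a : x ≤ a
  x≤a = ℕ.+-cancelʳ-≤ b x a (begin
    x ℕ.+ b                ≤⟨ ℕ.+-monoʳ-≤ x b≤y ⟩
    x ℕ.+ y                ≤⟨ ℕ.m≤m+n (x ℕ.+ y) (suc fuel) ⟩
    x ℕ.+ y ℕ.+ suc fuel   ≡⟨ cnt ⟩
    a ℕ.+ b                ∎)
  impossible : x ℕ.* b < x ℕ.* b
  impossible = begin-strict
    x ℕ.* b       ≤⟨ ℕ.*-monoˡ-≤ b x≤a ⟩
    a ℕ.* b       ≡⟨ ℕ.*-comm a b ⟩
    b ℕ.* a       ≤⟨ ℕ.*-monoˡ-≤ a b≤y ⟩
    y ℕ.* a       <⟨ ℕ.m<m+n (y ℕ.* a) 1≤a ⟩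
    y ℕ.* a ℕ.+ a ≤⟨ ℕ.+-monoʳ-≤ (y ℕ.* a) a≤D ⟩
    y ℕ.* a ℕ.+ D ≡⟨ inv ⟩
    x ℕ.* b       ∎

north-step-weakly-below : ∀ {a b} x y D → y ℕ.* a ℕ.+ D ≡ x ℕ.* b →
  a ≤ D → suc y ℕ.* a ≤ x ℕ.* b
north-step-weakly-below {a} x y D inv a≤D =
  subst (suc y ℕ.* a ≤_) (trans (ℕ.+-comm D (y ℕ.* a)) inv) (ℕ.+-monoˡ-≤ (y ℕ.* a) a≤D)

north-step-strictly-above : ∀ {a b} x y D → y ℕ.* a ℕ.+ D ≡ x ℕ.* b →
  ¬ a ≤ D → ¬ suc y ℕ.* a ≤ x ℕ.* b
north-step-strictly-above {a} x y D inv a≰D below = a≰D (ℕ.+-cancelʳ-≤ (y ℕ.* a) a D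
  (subst (a ℕ.+ y ℕ.* a ≤_) (trans (sym inv) (ℕ.+-comm (y ℕ.* a) D)) below))

pathFrom≡cuttingWord : ∀ {a b} x y D fuel → 1 ≤ a → y ℕ.* a ℕ.+ D ≡ x ℕ.* b →
  x ℕ.+ y ℕ.+ fuel ≡ a ℕ.+ b → pathFrom a b x y fuel ≡ cuttingWord a b D fuel
pathFrom≡cuttingWord x y D zero _ _ _ = refl
pathFrom≡cuttingWord {a} {b} x y D (suc fuel) 1≤a inv cnt with a ≤? D
... | yes a≤D
  rewrite ≤ᵇ-true (north-step-weakly-below x y D inv a≤D)
        | ≤ᵇ-true (north-step-below-top x y D fuel 1≤a inv cnt a≤D)
  = cong (N ∷_) (pathFrom≡cuttingWord x (suc y) (D ∸ a) fuel 1≤a inv′ cnt′)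
  where
  inv′ : suc y ℕ.* a ℕ.+ (D ∸ a) ≡ x ℕ.* b
  inv′ = begin
    a ℕ.+ y ℕ.* a ℕ.+ (D ∸ a)   ≡⟨ cong (ℕ._+ (D ∸ a)) (ℕ.+-comm a (y ℕ.* a)) ⟩
    y ℕ.* a ℕ.+ a ℕ.+ (D ∸ a)   ≡⟨ ℕ.+-assoc (y ℕ.* a) a (D ∸ a) ⟩
    y ℕ.* a ℕ.+ (a ℕ.+ (D ∸ a)) ≡⟨ cong (y ℕ.* a ℕ.+_) (ℕ.m+[n∸m]≡n a≤D) ⟩
    y ℕ.* a ℕ.+ D               ≡⟨ inv ⟩
    x ℕ.* b                     ∎
    where open ≡-Reasoning
  cnt′ : x ℕ.+ suc y ℕ.+ fuel ≡ a ℕ.+ b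
  cnt′ = trans (cong (ℕ._+ fuel) (ℕ.+-suc x y)) (trans (sym (ℕ.+-suc (x ℕ.+ y) fuel)) cnt)
... | no a≰D
  rewrite ≤ᵇ-false (north-step-strictly-above x y D inv a≰D)
  = cong (E ∷_) (pathFrom≡cuttingWord (suc x) y (D ℕ.+ b) fuel 1≤a inv′ cnt′)
  where
  inv′ : y ℕ.* a ℕ.+ (D ℕ.+ b) ≡ suc x ℕ.* b
  inv′ = trans (sym (ℕ.+-assoc (y ℕ.* a) D b)) (trans (cong (ℕ._+ b) inv) (ℕ.+-comm (x ℕ.* b) b))
  cnt′ : suc x ℕ.+ y ℕ.+ fuel ≡ a ℕ.+ b
  cnt′ = trans (sym (ℕ.+-suc (x ℕ.+ y) fuel)) cnt

shearE-cuttingWord : ∀ a b D m → D < a ℕ.+ b →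
  shearE (cuttingWord a b D m) ≡ cuttingWord (a ℕ.+ b) b D (m ℕ.+ #N (cuttingWord a b D m))
shearE-cuttingWord a b D zero D<a+b = refl
shearE-cuttingWord a b D (suc m) D<a+b with a ≤? D
... | yes a≤D = begin
  E ∷ N ∷ shearE (cuttingWord a b (D ∸ a) m)
    ≡⟨ cong (λ w → E ∷ N ∷ w) (shearE-cuttingWord a b (D ∸ a) m D∸a<a+b) ⟩
  E ∷ N ∷ cuttingWord (a ℕ.+ b) b (D ∸ a) (m ℕ.+ k)
    ≡⟨ cong (λ D′ → E ∷ N ∷ cuttingWord (a ℕ.+ b) b D′ (m ℕ.+ k)) D+b∸[a+b]≡D∸a ⟨
  E ∷ N ∷ cuttingWord (a ℕ.+ b) b (D ℕ.+ b ∸ (a ℕ.+ b)) (m ℕ.+ k)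
    ≡⟨ cong (E ∷_) (cuttingWord-N (ℕ.+-monoˡ-≤ b a≤D)) ⟨
  E ∷ cuttingWord (a ℕ.+ b) b (D ℕ.+ b) (suc (m ℕ.+ k))
    ≡⟨ cuttingWord-E (ℕ.<⇒≱ D<a+b) ⟨
  cuttingWord (a ℕ.+ b) b D (suc (suc (m ℕ.+ k)))
    ≡⟨ cong (λ n → cuttingWord (a ℕ.+ b) b D (suc n)) (ℕ.+-suc m k) ⟨
  cuttingWord (a ℕ.+ b) b D (suc (m ℕ.+ suc k)) ∎
  where
  open ≡-Reasoning
  k = #N (cuttingWord a b (D ∸ a) m)
  D∸a<a+b : D ∸ a < a ℕ.+ b
  D∸a<a+b = ℕ.≤-<-trans (ℕ.m∸n≤m D a) D<a+b
  D+b∸[a+b]≡D∸a : D ℕ.+ b ∸ (a ℕ.+ b) ≡ D ∸ a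
  D+b∸[a+b]≡D∸a = trans (cong₂ _∸_ (ℕ.+-comm D b) (ℕ.+-comm a b)) (ℕ.[m+n]∸[m+o]≡n∸o b D a)
... | no a≰D = begin
  E ∷ shearE (cuttingWord a b (D ℕ.+ b) m)
    ≡⟨ cong (E ∷_) (shearE-cuttingWord a b (D ℕ.+ b) m (ℕ.+-monoˡ-< b (ℕ.≰⇒> a≰D))) ⟩
  E ∷ cuttingWord (a ℕ.+ b) b (D ℕ.+ b) (m ℕ.+ #N (cuttingWord a b (D ℕ.+ b) m))
    ≡⟨ cuttingWord-E (ℕ.<⇒≱ D<a+b) ⟨
  cuttingWord (a ℕ.+ b) b D (suc m ℕ.+ #N (cuttingWord a b (D ℕ.+ b) m)) ∎
  where open ≡-Reasoning

shearN-cuttingWord : ∀ a b D m →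
  shearN (cuttingWord a b D m) ≡ cuttingWord a (a ℕ.+ b) D (m ℕ.+ #E (cuttingWord a b D m))
shearN-cuttingWord a b D zero = refl
shearN-cuttingWord a b D (suc m) with a ≤? D
... | yes _ = cong (N ∷_) (shearN-cuttingWord a b (D ∸ a) m)
... | no _ = cong (E ∷_) (begin
  N ∷ shearN (cuttingWord a b (D ℕ.+ b) m)
    ≡⟨ cong (N ∷_) (shearN-cuttingWord a b (D ℕ.+ b) m) ⟩
  N ∷ cuttingWord a (a ℕ.+ b) (D ℕ.+ b) (m ℕ.+ k)
    ≡⟨ cong (λ D′ → N ∷ cuttingWord a (a ℕ.+ b) D′ (m ℕ.+ k)) D+[a+b]∸a≡D+b ⟨
  N ∷ cuttingWord a (a ℕ.+ b) (D ℕ.+ (a ℕ.+ b) ∸ a) (m ℕ.+ k)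
    ≡⟨ cuttingWord-N a≤D+[a+b] ⟨
  cuttingWord a (a ℕ.+ b) (D ℕ.+ (a ℕ.+ b)) (suc (m ℕ.+ k))
    ≡⟨ cong (cuttingWord a (a ℕ.+ b) (D ℕ.+ (a ℕ.+ b))) (ℕ.+-suc m k) ⟨
  cuttingWord a (a ℕ.+ b) (D ℕ.+ (a ℕ.+ b)) (m ℕ.+ suc k) ∎)
  where
  open ≡-Reasoning
  k = #E (cuttingWord a b (D ℕ.+ b) m)
  a≤D+[a+b] : a ≤ D ℕ.+ (a ℕ.+ b)
  a≤D+[a+b] = ℕ.≤-trans (ℕ.m≤m+n a b) (ℕ.m≤n+m (a ℕ.+ b) D)
  D+[a+b]∸a≡D+b : D ℕ.+ (a ℕ.+ b) ∸ a ≡ D ℕ.+ b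
  D+[a+b]∸a≡D+b = begin
    D ℕ.+ (a ℕ.+ b) ∸ a ≡⟨ cong (_∸ a) (ℕ.+-assoc D a b) ⟨
    D ℕ.+ a ℕ.+ b ∸ a   ≡⟨ cong (λ n → n ℕ.+ b ∸ a) (ℕ.+-comm D a) ⟩
    a ℕ.+ D ℕ.+ b ∸ a   ≡⟨ cong (_∸ a) (ℕ.+-assoc a D b) ⟩
    a ℕ.+ (D ℕ.+ b) ∸ a ≡⟨ ℕ.m+n∸m≡n a (D ℕ.+ b) ⟩
    D ℕ.+ b             ∎

record ChristoffelCounts (a b : ℕ) : Set where
  field
    #E-cuttingWord : #E (cuttingWord a b 0 (a ℕ.+ b)) ≡ a
    #N-cuttingWord : #N (cuttingWord a b 0 (a ℕ.+ b)) ≡ b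
    pairBalance-cuttingWord : pairBalance (cuttingWord a b 0 (a ℕ.+ b)) ≡ + a + + b - + 1

counts-shearE : ∀ {a b} → 1 ≤ a → ChristoffelCounts a b → ChristoffelCounts (a ℕ.+ b) b
counts-shearE {a} {b} 1≤a counts = record
  { #E-cuttingWord = trans (cong #E (sym shear≡)) (trans (#E-shearE w) (cong₂ ℕ._+_ #E-cuttingWord #N-cuttingWord))
  ; #N-cuttingWord = trans (cong #N (sym shear≡)) (trans (#N-shearE w) #N-cuttingWord)
  ; pairBalance-cuttingWord = begin
      pairBalance (cuttingWord (a ℕ.+ b) b 0 (a ℕ.+ b ℕ.+ b)) ≡⟨ cong pairBalance shear≡ ⟨
      pairBalance (shearE w)                                ≡⟨ pairBalance-shearE w ⟩
      pairBalance w + + #N w                                ≡⟨ cong₂ _+_ pairBalance-cuttingWord (cong +_ #N-cuttingWord) ⟩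
      + a + + b - + 1 + + b                                 ≡⟨ regroup (+ a) (+ b) ⟩
      + a + + b + + b - + 1                                 ≡⟨ cong (λ i → i + + b - + 1) (ℤ.pos-+ a b) ⟨
      + (a ℕ.+ b) + + b - + 1                               ∎
  }
  where
  open ChristoffelCounts counts
  open ≡-Reasoning
  w = cuttingWord a b 0 (a ℕ.+ b)
  shear≡ : shearE w ≡ cuttingWord (a ℕ.+ b) b 0 (a ℕ.+ b ℕ.+ b)
  shear≡ = trans (shearE-cuttingWord a b 0 (a ℕ.+ b) (ℕ.≤-trans 1≤a (ℕ.m≤m+n a b)))
                 (cong (λ n → cuttingWord (a ℕ.+ b) b 0 (a ℕ.+ b ℕ.+ n)) #N-cuttingWord)
  regroup : ∀ x y → x + y - + 1 + y ≡ x + y + y - + 1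
  regroup = solve-∀

counts-shearN : ∀ {a b} → ChristoffelCounts a b → ChristoffelCounts a (a ℕ.+ b)
counts-shearN {a} {b} counts = record
  { #E-cuttingWord = trans (cong #E (sym shear≡)) (trans (#E-shearN w) #E-cuttingWord)
  ; #N-cuttingWord = trans (cong #N (sym shear≡))
      (trans (#N-shearN w) (trans (cong₂ ℕ._+_ #N-cuttingWord #E-cuttingWord) (ℕ.+-comm b a)))
  ; pairBalance-cuttingWord = begin
      pairBalance (cuttingWord a (a ℕ.+ b) 0 (a ℕ.+ (a ℕ.+ b))) ≡⟨ cong pairBalance shear≡ ⟨
      pairBalance (shearN w)                                  ≡⟨ pairBalance-shearN w ⟩
      pairBalance w + + #E w                                  ≡⟨ cong₂ _+_ pairBalance-cuttingWord (cong +_ #E-cuttingWord) ⟩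
      + a + + b - + 1 + + a                                   ≡⟨ regroup (+ a) (+ b) ⟩
      + a + (+ a + + b) - + 1                                 ≡⟨ cong (λ i → + a + i - + 1) (ℤ.pos-+ a b) ⟨
      + a + + (a ℕ.+ b) - + 1                                 ∎
  }
  where
  open ChristoffelCounts counts
  open ≡-Reasoning
  w = cuttingWord a b 0 (a ℕ.+ b)
  shear≡ : shearN w ≡ cuttingWord a (a ℕ.+ b) 0 (a ℕ.+ (a ℕ.+ b))
  shear≡ = trans (shearN-cuttingWord a b 0 (a ℕ.+ b))
                 (cong (cuttingWord a (a ℕ.+ b) 0) (trans (cong (a ℕ.+ b ℕ.+_) #E-cuttingWord) (ℕ.+-comm (a ℕ.+ b) a)))
  regroup : ∀ x y → x + y - + 1 + x ≡ x + (x + y) - + 1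
  regroup = solve-∀

coprime-∸ˡ : ∀ {m n} → m ≤ n → Coprime m n → Coprime m (n ∸ m)
coprime-∸ˡ m≤n cop (d∣m , d∣n∸m) = cop (d∣m , subst (_ ∣_) (ℕ.m+[n∸m]≡n m≤n) (∣m∣n⇒∣m+n d∣m d∣n∸m))

coprime-∸ʳ : ∀ {m n} → n ≤ m → Coprime m n → Coprime (m ∸ n) n
coprime-∸ʳ n≤m cop (d∣m∸n , d∣n) = cop (subst (_ ∣_) (ℕ.m∸n+n≡m n≤m) (∣m∣n⇒∣m+n d∣m∸n d∣n) , d∣n)

coprime⇒counts′ : ∀ k {a b} → a ℕ.+ b ≤ k → 1 ≤ a → Coprime a b → ChristoffelCounts a b
coprime⇒counts′ zero {suc a} () _ _
coprime⇒counts′ (suc k) {a} {zero} _ _ cop with 0-coprimeTo-m⇒m≡1 (Coprime.sym cop)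
... | refl = record { #E-cuttingWord = refl ; #N-cuttingWord = refl ; pairBalance-cuttingWord = refl }
coprime⇒counts′ (suc k) {a} {b@(suc _)} a+b≤1+k 1≤a cop with ℕ.<-cmp a b
... | tri< a<b _ _ =
  subst (ChristoffelCounts a) (ℕ.m+[n∸m]≡n (ℕ.<⇒≤ a<b))
    (counts-shearN (coprime⇒counts′ k (ℕ.≤-pred (ℕ.≤-trans a+[b∸a]<a+b a+b≤1+k)) 1≤a (coprime-∸ˡ (ℕ.<⇒≤ a<b) cop)))
  where
  a+[b∸a]<a+b : a ℕ.+ (b ∸ a) < a ℕ.+ b
  a+[b∸a]<a+b = subst (_< a ℕ.+ b) (sym (ℕ.m+[n∸m]≡n (ℕ.<⇒≤ a<b))) (ℕ.m<n+m b 1≤a)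
... | tri≈ _ refl _ with cop (∣-refl , ∣-refl)
...   | refl = record { #E-cuttingWord = refl ; #N-cuttingWord = refl ; pairBalance-cuttingWord = refl }
coprime⇒counts′ (suc k) {a} {b@(suc _)} a+b≤1+k 1≤a cop | tri> _ _ b<a =
  subst (λ a′ → ChristoffelCounts a′ b) (ℕ.m∸n+n≡m (ℕ.<⇒≤ b<a))
    (counts-shearE 1≤a∸b (coprime⇒counts′ k (ℕ.≤-pred (ℕ.≤-trans [a∸b]+b<a+b a+b≤1+k)) 1≤a∸b (coprime-∸ʳ (ℕ.<⇒≤ b<a) cop)))
  where
  1≤a∸b : 1 ≤ a ∸ b
  1≤a∸b = ℕ.m<n⇒0<n∸m b<a
  [a∸b]+b<a+b : a ∸ b ℕ.+ b < a ℕ.+ b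
  [a∸b]+b<a+b = subst (_< a ℕ.+ b) (sym (ℕ.m∸n+n≡m (ℕ.<⇒≤ b<a))) (ℕ.m<m+n a (s≤s z≤n))

coprime⇒counts : ∀ {a b} → 1 ≤ a → Coprime a b → ChristoffelCounts a b
coprime⇒counts {a} {b} = coprime⇒counts′ (a ℕ.+ b) ℕ.≤-refl

wq-christoffel : ∀ r {a b} → Coprime a b → wq r (map toHv (christoffel a b)) ≡ + a + + b - + 1
wq-christoffel r {zero} cop with 0-coprimeTo-m⇒m≡1 cop
... | refl = refl
wq-christoffel r {a@(suc _)} {b} cop = begin
  wq r (map toHv (christoffel a b))        ≡⟨ wq-toHv r (christoffel a b) ⟩
  pairBalance (pathFrom a b 0 0 (a ℕ.+ b)) ≡⟨ cong pairBalance (pathFrom≡cuttingWord 0 0 0 (a ℕ.+ b) (s≤s z≤n) refl refl) ⟩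
  pairBalance (cuttingWord a b 0 (a ℕ.+ b)) ≡⟨ ChristoffelCounts.pairBalance-cuttingWord (coprime⇒counts (s≤s z≤n) cop) ⟩
  + a + + b - + 1                          ∎
  where open ≡-Reasoning

cℕ : ℕ → ℕ → ℕ
cℕ r zero = 0
cℕ r (suc zero) = 1
cℕ r (suc (suc k)) = r ℕ.* cℕ r (suc k) ∸ cℕ r k

module _ {r : ℕ} (2≤r : 2 ≤ r) where

  m+m≤r*m : ∀ m → m ℕ.+ m ≤ r ℕ.* m
  m+m≤r*m m = subst (_≤ r ℕ.* m) (cong (m ℕ.+_) (ℕ.+-identityʳ m)) (ℕ.*-monoˡ-≤ m 2≤r)

  cℕ-mono : ∀ k → cℕ r k ≤ cℕ r (suc k)
  cℕ-mono zero = z≤n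
  cℕ-mono (suc k) = ℕ.m+n≤o⇒m≤o∸n (cℕ r (suc k))
    (ℕ.≤-trans (ℕ.+-monoʳ-≤ (cℕ r (suc k)) (cℕ-mono k)) (m+m≤r*m (cℕ r (suc k))))

  cℕ≤r*cℕ : ∀ k → cℕ r k ≤ r ℕ.* cℕ r (suc k)
  cℕ≤r*cℕ k = ℕ.≤-trans (cℕ-mono k) (ℕ.≤-trans (ℕ.m≤m+n _ _) (m+m≤r*m _))

  c≡cℕ : ∀ k → c r (suc k) ≡ + cℕ r k
  c≡cℕ zero = refl
  c≡cℕ (suc zero) = cong (_- ℤ.-[1+ 0 ]) (ℤ.*-zeroʳ (+ r))
  c≡cℕ (suc (suc k)) = begin
    + r ℤ.* c r (suc (suc k)) - c r (suc k)
      ≡⟨ cong₂ (λ x y → + r ℤ.* x - y) (c≡cℕ (suc k)) (c≡cℕ k) ⟩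
    + r ℤ.* + cℕ r (suc k) - + cℕ r k
      ≡⟨ cong (_- + cℕ r k) (ℤ.pos-* r (cℕ r (suc k))) ⟨
    + (r ℕ.* cℕ r (suc k)) - + cℕ r k
      ≡⟨ ℤ.m-n≡m⊖n (r ℕ.* cℕ r (suc k)) (cℕ r k) ⟩
    r ℕ.* cℕ r (suc k) ℤ.⊖ cℕ r k
      ≡⟨ ℤ.⊖-≥ (cℕ≤r*cℕ k) ⟩
    + cℕ r (suc (suc k)) ∎
    where open ≡-Reasoning

  cℕ-coprime : ∀ k → Coprime (cℕ r (suc k)) (cℕ r k)
  cℕ-coprime zero (d∣1 , _) = ∣1⇒≡1 d∣1
  cℕ-coprime (suc k) {d} (d∣cₖ₊₂ , d∣cₖ₊₁) = cℕ-coprime k (d∣cₖ₊₁ , d∣cₖ)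
    where
    cₖ₊₂+cₖ≡r*cₖ₊₁ : cℕ r (suc (suc k)) ℕ.+ cℕ r k ≡ r ℕ.* cℕ r (suc k)
    cₖ₊₂+cₖ≡r*cₖ₊₁ = ℕ.m∸n+n≡m (cℕ≤r*cℕ k)
    d∣cₖ : d ∣ cℕ r k
    d∣cₖ = ∣m+n∣m⇒∣n (subst (d ∣_) (sym cₖ₊₂+cₖ≡r*cₖ₊₁) (∣-trans d∣cₖ₊₁ (n∣m*n r))) d∣cₖ₊₂

lemma6p3 : (r n : ℕ) → 2 ≤ r → 3 ≤ n →
    wq r (u r n) ≡ c r (n ∸ 1) + c r (n ∸ 2) - + 1
lemma6p3 r (suc zero) _ (s≤s ())
lemma6p3 r (suc (suc zero)) _ (s≤s (s≤s ()))
lemma6p3 r (suc (suc (suc j))) 2≤r _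
  rewrite c≡cℕ 2≤r (suc j) | c≡cℕ 2≤r j = wq-christoffel r (cℕ-coprime 2≤r j)
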